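{- Let $k\ge1$, $n=2k$, and let $a_1,\dots,a_n$ be positive integers with $\max_i a_i/\min_i a_i\le1+\frac1{100k}$. Let $(\mathcal{D},f)$ be the instance constructed from $(a_1,\dots,a_n)$ as described in the context. Then every partition $\mathcal{P}$ of $\mathcal{X}$ that is not regular satisfies $\mathsf{cost}_{\mathcal{D},f}(\mathcal{P})>\frac1{36k}$.
   Context: Construction: let $S=\sum_i a_i$, $\epsilon_i=a_i/S$, $\epsilon=\frac1{6k}$, $\delta=\frac1{4k}$. The domain is $\mathcal{X}=\{x_1,\dots,x_n\}\cup\{x'_1,\dots,x'_n\}\cup\{x''_1,\dots,x''_n\}$ ($3n$ distinct elements); $\mathcal{D}$ over $\mathcal{X}\times\{0,1\}$ has uniform $\mathcal{X}$-marginal $\mathcal{D}_x$ and conditional probabilities $\mu(x)=\Pr[y=1\mid x]$: $\mu(x_i)=\frac12+\epsilon_i$, $\mu(x'_i)=\frac12-\delta$, $\mu(x''_i)=\frac12$; predictor $f(x_i)=f(x'_i)=\frac12$, $f(x''_i)=\frac12+\epsilon$. For nonempty $\mathcal{X}'\subseteq\mathcal{X}$, $\mu(\mathcal{X}')=\Pr[y=1\mid x\in\mathcal{X}']$ and $\mathsf{cost}_{\mathcal{D},f}(\mathcal{X}')=\sum_{x\in\mathcal{X}'}\mathcal{D}_x(x)|f(x)-\mu(\mathcal{X}')|$; the cost of a partition is the sum of the costs of its parts. The signature of $\mathcal{X}'$ is $(a,b,c)$ where $a,b,c$ are the numbers of $x$-, $x'$-, $x''$-elements in $\mathcal{X}'$.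 A partition is regular if every part has signature $(t,2t,0)$ or $(t,0,2t)$ for some integer $t$ (depending on the part). -}

module Defs where

open import Data.Nat as ℕ using (ℕ; zero; suc)
open import Data.Integer using (+_)
open import Data.Fin using (Fin)
open import Data.Fin.Properties using () renaming (_≟_ to _≟ᶠ_)
open import Data.List using (List; []; _∷_; map; _++_; filter; length; foldr)
open import Data.List.Base using (allFin)
open import Data.Product using (Σ; _×_; _,_; ∃-syntax)
open import Data.Sum using (_⊎_)
open import Relation.Binary.PropositionalEquality using (_≡_)
open import Relation.Nullary using (¬_; yes; no)
open import Data.Rational using (ℚ; 0ℚ; 1ℚ; ½; _+_; _-_; _*_; _÷_; ∣_∣; _/_)
open import Data.Rational using (≢-nonZero)
open import Data.Rational.Properties using (_≟_)

ℕ→ℚ : ℕ → ℚ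
ℕ→ℚ m = + m / 1

-- total division: p ÷ q when q ≠ 0, and 0 when q = 0.
-- (only ever used with nonzero denominators below)
_÷₀_ : ℚ → ℚ → ℚ
p ÷₀ q with q ≟ 0ℚ
... | yes _  = 0ℚ
... | no q≢0 = _÷_ p q {{≢-nonZero q≢0}}

sumℚ : List ℚ → ℚ
sumℚ = foldr _+_ 0ℚ

data Elem (n : ℕ) : Set where
  x   : Fin n → Elem n
  x′  : Fin n → Elem n
  x″  : Fin n → Elem n

allElems : (n : ℕ) → List (Elem n)
allElems n = map x (allFin n) ++ map x′ (allFin n) ++ map x″ (allFin n)

module Instance (k : ℕ) (a : Fin (2 ℕ.* k) → ℕ) where

  n : ℕ
  n = 2 ℕ.* k

  S : ℚ
  S = sumℚ (map (λ i → ℕ→ℚ (a i)) (allFin n))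

  εᵢ : Fin n → ℚ
  εᵢ i = ℕ→ℚ (a i) ÷₀ S

  ε : ℚ
  ε = 1ℚ ÷₀ ℕ→ℚ (6 ℕ.* k)

  δ : ℚ
  δ = 1ℚ ÷₀ ℕ→ℚ (4 ℕ.* k)

  Dx : Elem n → ℚ
  Dx _ = 1ℚ ÷₀ ℕ→ℚ (3 ℕ.* n)

  -- μ(x) = Pr[y = 1 | x]
  μ : Elem n → ℚ
  μ (x i)  = ½ + εᵢ i
  μ (x′ i) = ½ - δ
  μ (x″ i) = ½

  f : Elem n → ℚ
  f (x i)  = ½
  f (x′ i) = ½
  f (x″ i) = ½ + ε

  -- μ(𝒳') = Pr[y = 1 | x ∈ 𝒳'] for a subset given as a duplicate-free list
  μSet : List (Elem n) → ℚ
  μSet X′ = sumℚ (map (λ e → Dx e * μ e) X′) ÷₀ sumℚ (map Dx X′)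

  costSet : List (Elem n) → ℚ
  costSet X′ = sumℚ (map (λ e → Dx e * ∣ f e - μSet X′ ∣) X′)

  -- Partitions of 𝒳 are given by a labelling  P : Elem n → Fin m;
  -- the parts are the nonempty fibres P⁻¹(j).

  part : ∀ {m} → (Elem n → Fin m) → Fin m → List (Elem n)
  part P j = filter (λ e → P e ≟ᶠ j) (allElems n)

  -- cost of a partition = sum of the costs of its parts
  -- (empty fibres are not parts; they contribute costSet [] = 0)
  cost : ∀ {m} → (Elem n → Fin m) → ℚ
  cost {m} P = sumℚ (map (λ j → costSet (part P j)) (allFin m))

  signature : List (Elem n) → ℕ × ℕ × ℕ
  signature [] = 0 , 0 , 0
  signature (x _  ∷ es) with signature es
  ... | (p , q , r) = suc p , q , r
  signature (x′ _ ∷ es) with signature es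
  ... | (p , q , r) = p , suc q , r
  signature (x″ _ ∷ es) with signature es
  ... | (p , q , r) = p , q , suc r

  RegularPart : List (Elem n) → Set
  RegularPart X′ = ∃[ t ] (signature X′ ≡ (t , 2 ℕ.* t , 0) ⊎ signature X′ ≡ (t , 0 , 2 ℕ.* t))

  Regular : ∀ {m} → (Elem n → Fin m) → Set
  Regular {m} P = ∀ (j : Fin m) → ¬ (part P j ≡ []) → RegularPart (part P j)

{-# OPTIONS --safe #-}
-- Measure everything in the unit u = 1/(12k): then ε = 2u, δ = 3u, every point has mass 2u, and the
-- balance of the aᵢ gives εᵢ ≥ 6u(1 − ρ) with ρ = 1/(100k).  Take a part with a x-, b x′- and c x″-elements,
-- and let β be 1 if it is not regular and 0 otherwise.  Its deviation Σ |f − μ(part)| is at least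
-- u(4a − 2b − c − 6ρa + β):
--  * if β + b + c ≤ 2a, because it is at least Σ (μ(part) − f), which is Σ (μ − f) as μ(part) is the
--    average of μ over the part, and Σ (μ − f) ≥ u(6(1 − ρ)a − 3b − 2c);
--  * otherwise, because f is ½ on a + b points and ½ + ε on c points, so that the deviation is at least
--    ε · min (a + b, c), which for integers a, b, c outside the first case is at least u(4a − 2b − c + β).
-- Over a partition the terms 4a − 2b − c − 6ρa add up to n(1 − 6ρ), and a non-regular partition has a
-- non-regular part, so its cost is at least 2u · u(n(1 − 6ρ) + 1) = 1/(36k) + (1/72 − 1/600)/k².
module Submission where

module RegularSignatures where

  open import Data.Nat using (ℕ; zero; suc; _+_; _*_; _≤_; _<_; _≤?_; _≟_; z≤n; s≤s; s≤s⁻¹)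
  open import Data.Nat.Properties
    using ( *-monoʳ-≤; +-monoʳ-≤; +-monoˡ-≤; m≤m+n; m≤n+m; n≤1+n; +-identityʳ
          ; ≤∧≢⇒<; <⇒≤; ≰⇒>; module ≤-Reasoning)
  open import Data.Nat.Tactic.RingSolver using (solve)
  open import Data.List using ([]; _∷_)
  open import Data.Product using (_×_; _,_; ∃-syntax)
  open import Data.Sum using (_⊎_; inj₁; inj₂)
  open import Data.Empty using (⊥-elim)
  open import Relation.Nullary using (¬_; Dec; yes; no)
  open import Relation.Nullary.Decidable using (map′; _×-dec_; _⊎-dec_)
  open import Relation.Binary.PropositionalEquality using (_≡_; refl; sym; cong; subst)

  -- Instance.RegularPart X is, by definition, RegularShape (Instance.signature X).
  RegularShape : ℕ × ℕ × ℕ → Set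
  RegularShape s = ∃[ t ] (s ≡ (t , 2 * t , 0) ⊎ s ≡ (t , 0 , 2 * t))

  regularShape? : ∀ s → Dec (RegularShape s)
  regularShape? (A , B , C) =
    map′ shape equations ((B ≟ 2 * A ×-dec C ≟ 0) ⊎-dec (B ≟ 0 ×-dec C ≟ 2 * A))
    where
    shape : (B ≡ 2 * A × C ≡ 0) ⊎ (B ≡ 0 × C ≡ 2 * A) → RegularShape (A , B , C)
    shape (inj₁ (refl , refl)) = A , inj₁ refl
    shape (inj₂ (refl , refl)) = A , inj₂ refl
    equations : RegularShape (A , B , C) → (B ≡ 2 * A × C ≡ 0) ⊎ (B ≡ 0 × C ≡ 2 * A)
    equations (_ , inj₁ refl) = inj₁ (refl , refl)
    equations (_ , inj₂ refl) = inj₂ (refl , refl)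

  irregularity : ℕ × ℕ × ℕ → ℕ
  irregularity s with regularShape? s
  ... | yes _ = 0
  ... | no  _ = 1

  irregularity-≡1 : ∀ s → ¬ RegularShape s → irregularity s ≡ 1
  irregularity-≡1 s ¬regular with regularShape? s
  ... | yes regular = ⊥-elim (¬regular regular)
  ... | no  _       = refl

  spread-bounds : ∀ A B C → 2 * A ≤ B + C → 4 * A ≤ 2 * B + 3 * C × 2 * A ≤ 4 * B + C
  spread-bounds A B C 2A≤B+C = (begin
    4 * A              ≡⟨ solve (A ∷ []) ⟩
    2 * (2 * A)        ≤⟨ *-monoʳ-≤ 2 2A≤B+C ⟩
    2 * (B + C)        ≤⟨ m≤m+n _ C ⟩
    2 * (B + C) + C    ≡⟨ solve (B ∷ C ∷ []) ⟩
    2 * B + 3 * C      ∎) , (begin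
    2 * A              ≤⟨ 2A≤B+C ⟩
    B + C              ≤⟨ m≤n+m _ (3 * B) ⟩
    3 * B + (B + C)    ≡⟨ solve (B ∷ C ∷ []) ⟩
    4 * B + C          ∎)
    where open ≤-Reasoning

  spread-bound₁⁺ : ∀ A B C → ¬ RegularShape (A , B , C) → 2 * A ≤ B + C → 1 + 4 * A ≤ 2 * B + 3 * C
  spread-bound₁⁺ A B (suc c) _ 2A≤B+C = begin
    1 + 4 * A                  ≡⟨ solve (A ∷ []) ⟩
    1 + 2 * (2 * A)            ≤⟨ +-monoʳ-≤ 1 (*-monoʳ-≤ 2 2A≤B+C) ⟩
    1 + 2 * (B + suc c)        ≤⟨ +-monoˡ-≤ (2 * (B + suc c)) (s≤s {n = c} z≤n) ⟩
    suc c + 2 * (B + suc c)    ≡⟨ solve (B ∷ c ∷ []) ⟩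
    2 * B + 3 * suc c          ∎
    where open ≤-Reasoning
  spread-bound₁⁺ A B zero irregular 2A≤B+0 = begin
    1 + 4 * A                  ≤⟨ n≤1+n _ ⟩
    2 + 4 * A                  ≡⟨ solve (A ∷ []) ⟩
    2 * suc (2 * A)            ≤⟨ *-monoʳ-≤ 2 2A<B ⟩
    2 * B                      ≡⟨ solve (B ∷ []) ⟩
    2 * B + 3 * 0              ∎
    where
    open ≤-Reasoning
    2A<B : 2 * A < B
    2A<B = ≤∧≢⇒< (subst (2 * A ≤_) (+-identityʳ B) 2A≤B+0)
                 (λ 2A≡B → irregular (A , inj₁ (cong (λ b → A , b , 0) (sym 2A≡B))))

  spread-bound₂⁺ : ∀ A B C → ¬ RegularShape (A , B , C) → 2 * A ≤ B + C → 1 + 2 * A ≤ 4 * B + C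
  spread-bound₂⁺ A (suc b) C _ 2A≤B+C = begin
    1 + 2 * A                  ≤⟨ +-monoʳ-≤ 1 2A≤B+C ⟩
    1 + (suc b + C)            ≤⟨ +-monoˡ-≤ (suc b + C) (s≤s {n = b + 2 * suc b} z≤n) ⟩
    3 * suc b + (suc b + C)    ≡⟨ solve (b ∷ C ∷ []) ⟩
    4 * suc b + C              ∎
    where open ≤-Reasoning
  spread-bound₂⁺ A zero C irregular 2A≤C =
    ≤∧≢⇒< 2A≤C (λ 2A≡C → irregular (A , inj₂ (cong (λ c → A , 0 , c) (sym 2A≡C))))

  above-or-spread : ∀ A B C → let β = irregularity (A , B , C) in
                    β + (B + C) ≤ 2 * A ⊎ (β + 4 * A ≤ 2 * B + 3 * C × β + 2 * A ≤ 4 * B + C)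
  above-or-spread A B C with irregularity (A , B , C) + (B + C) ≤? 2 * A
  ... | yes above = inj₁ above
  ... | no ¬above with regularShape? (A , B , C)
  ...   | yes _        = inj₂ (spread-bounds A B C (<⇒≤ (≰⇒> ¬above)))
  ...   | no irregular =
    inj₂ (spread-bound₁⁺ A B C irregular 2A≤B+C , spread-bound₂⁺ A B C irregular 2A≤B+C)
    where
    2A≤B+C : 2 * A ≤ B + C
    2A≤B+C = s≤s⁻¹ (≰⇒> ¬above)

-- Kept apart from the statement at the end, whose _*_ is that of ℕ and whose literals are not overloaded.
module CostLowerBound where

  open import Defs
  open RegularSignatures
  open import Agda.Builtin.FromNat using (Number; fromNat)
  open import Data.Unit.Base using (tt)
  open import Data.Bool using (true; false; if_then_else_)
  open import Data.Empty using (⊥-elim)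
  open import Data.Nat as ℕ using (ℕ; suc)
  import Data.Nat.Literals as ℕ
  import Data.Nat.Properties as ℕ
  import Data.Integer as ℤ
  import Data.Integer.Properties as ℤ
  import Data.Nat.Coprimality as Coprimality
  open import Data.Rational as ℚ
    using (ℚ; mkℚ; 0ℚ; 1ℚ; ½; _+_; _*_; _-_; -_; _≤_; _<_; ∣_∣; _⊓_; *≤*; *<*; ≢-nonZero)
  import Data.Rational.Literals as ℚ
  open import Data.Rational.Properties as ℚ using (≤-refl; ≤-trans; ≤-reflexive; module ≤-Reasoning)
  open import Data.Rational.Solver using (module +-*-Solver)
  open +-*-Solver using (solve; _:=_; con; _:+_; _:*_; _:-_; :-_)
  open import Data.Fin as Fin using (Fin)
  import Data.Fin.Properties as Fin
  open import Data.List using (List; []; _∷_; map; _++_; filter; length)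
  open import Data.List.Base using (allFin)
  import Data.List.Properties as List
  open import Data.Product using (_×_; _,_; ∃-syntax; proj₁; proj₂; uncurry)
  import Data.Product as Product
  open import Data.Sum using (_⊎_; inj₁; inj₂)
  import Data.Sum as Sum
  open import Function using (_∘_; id)
  open import Algebra.Bundles using (CommutativeMonoid)
  open import Algebra.Properties.CommutativeSemigroup
    (CommutativeMonoid.commutativeSemigroup ℚ.+-0-commutativeMonoid) using (interchange)
  open import Relation.Binary.PropositionalEquality
  open import Relation.Nullary using (¬_; yes; no; does)

  -- With fromNat in scope literals are overloaded, and tt discharges their trivial constraints.  The
  -- arity of a solve is then elaborated late, so its normal-form proof is written λ {_ …} → refl.
  instance
    ℕ-number : Number ℕ
    ℕ-number = ℕ.number
    ℚ-number : Number ℚ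
    ℚ-number = ℚ.number

  ℕ→ℚ≡mkℚ : ∀ m → ℕ→ℚ m ≡ mkℚ (ℤ.+ m) 0 (Coprimality.sym (Coprimality.1-coprimeTo m))
  ℕ→ℚ≡mkℚ m = ℚ.normalize-coprime (Coprimality.sym (Coprimality.1-coprimeTo m))

  ℕ→ℚ-+ : ∀ m n → ℕ→ℚ (m ℕ.+ n) ≡ ℕ→ℚ m + ℕ→ℚ n
  ℕ→ℚ-+ m n rewrite ℕ→ℚ≡mkℚ m | ℕ→ℚ≡mkℚ n =
    cong (ℚ._/ 1) (sym (cong₂ ℤ._+_ (ℤ.*-identityʳ (ℤ.+ m)) (ℤ.*-identityʳ (ℤ.+ n))))

  ℕ→ℚ-* : ∀ m n → ℕ→ℚ (m ℕ.* n) ≡ ℕ→ℚ m * ℕ→ℚ n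
  ℕ→ℚ-* m n rewrite ℕ→ℚ≡mkℚ m | ℕ→ℚ≡mkℚ n = cong (ℚ._/ 1) (ℤ.pos-* m n)

  ℕ→ℚ-mono-≤ : ∀ {m n} → m ℕ.≤ n → ℕ→ℚ m ≤ ℕ→ℚ n
  ℕ→ℚ-mono-≤ {m} {n} m≤n rewrite ℕ→ℚ≡mkℚ m | ℕ→ℚ≡mkℚ n =
    *≤* (subst₂ ℤ._≤_ (sym (ℤ.*-identityʳ (ℤ.+ m))) (sym (ℤ.*-identityʳ (ℤ.+ n))) (ℤ.+≤+ m≤n))

  ℕ→ℚ-mono-< : ∀ {m n} → m ℕ.< n → ℕ→ℚ m < ℕ→ℚ n
  ℕ→ℚ-mono-< {m} {n} m<n rewrite ℕ→ℚ≡mkℚ m | ℕ→ℚ≡mkℚ n =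
    *<* (subst₂ ℤ._<_ (sym (ℤ.*-identityʳ (ℤ.+ m))) (sym (ℤ.*-identityʳ (ℤ.+ n))) (ℤ.+<+ m<n))

  ℕ→ℚ-nonNeg : ∀ m → 0ℚ ≤ ℕ→ℚ m
  ℕ→ℚ-nonNeg m = ℕ→ℚ-mono-≤ {n = m} ℕ.z≤n

  ℕ→ℚ-pos : ∀ m → 0ℚ < ℕ→ℚ (suc m)
  ℕ→ℚ-pos m = ℕ→ℚ-mono-< {n = suc m} (ℕ.s≤s ℕ.z≤n)

  pos⇒≢0 : ∀ {p} → 0ℚ < p → p ≢ 0ℚ
  pos⇒≢0 0<p p≡0 = ℚ.<-irrefl (sym p≡0) 0<p

  *-pos : ∀ {p q} → 0ℚ < p → 0ℚ < q → 0ℚ < p * q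
  *-pos {p} {q} 0<p 0<q = ℚ.positive⁻¹ _ {{ℚ.pos*pos⇒pos p {{ℚ.positive 0<p}} q {{ℚ.positive 0<q}}}}

  *-nonNeg : ∀ {p q} → 0ℚ ≤ p → 0ℚ ≤ q → 0ℚ ≤ p * q
  *-nonNeg {p} {q} 0≤p 0≤q =
    ℚ.nonNegative⁻¹ _ {{ℚ.nonNeg*nonNeg⇒nonNeg p {{ℚ.nonNegative 0≤p}} q {{ℚ.nonNegative 0≤q}}}}

  *-monoˡ-≤ : ∀ {r p q} → 0ℚ ≤ r → p ≤ q → r * p ≤ r * q
  *-monoˡ-≤ {r} 0≤r = ℚ.*-monoˡ-≤-nonNeg r {{ℚ.nonNegative 0≤r}}

  *-monoʳ-≤ : ∀ {r p q} → 0ℚ ≤ r → p ≤ q → p * r ≤ q * r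
  *-monoʳ-≤ {r} 0≤r = ℚ.*-monoʳ-≤-nonNeg r {{ℚ.nonNegative 0≤r}}

  *-cancelˡ-≤ : ∀ {r p q} → 0ℚ < r → r * p ≤ r * q → p ≤ q
  *-cancelˡ-≤ {r} 0<r = ℚ.*-cancelˡ-≤-pos r {{ℚ.positive 0<r}}

  *-cancelʳ-≤ : ∀ {r p q} → 0ℚ < r → p * r ≤ q * r → p ≤ q
  *-cancelʳ-≤ {r} 0<r = ℚ.*-cancelʳ-≤-pos r {{ℚ.positive 0<r}}

  ≤-by-slack : ∀ {p q} s → 0ℚ ≤ s → q ≡ p + s → p ≤ q
  ≤-by-slack {p} {q} s 0≤s q≡p+s = begin
    p        ≡⟨ sym (ℚ.+-identityʳ p) ⟩
    p + 0ℚ   ≤⟨ ℚ.+-monoʳ-≤ p 0≤s ⟩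
    p + s    ≡⟨ sym q≡p+s ⟩
    q        ∎
    where open ≤-Reasoning

  p≤q⇒0≤q-p : ∀ {p q} → p ≤ q → 0ℚ ≤ q - p
  p≤q⇒0≤q-p {p} {q} p≤q = begin
    0ℚ      ≡⟨ sym (ℚ.+-inverseʳ p) ⟩
    p - p   ≤⟨ ℚ.+-monoˡ-≤ (- p) p≤q ⟩
    q - p   ∎
    where open ≤-Reasoning

  p≤∣p∣ : ∀ p → p ≤ ∣ p ∣
  p≤∣p∣ p with ℚ.≤-total 0ℚ p
  ... | inj₁ 0≤p = ≤-reflexive (sym (ℚ.0≤p⇒∣p∣≡p 0≤p))
  ... | inj₂ p≤0 = ≤-trans p≤0 (ℚ.0≤∣p∣ p)

  p-q≤∣q-p∣ : ∀ p q → p - q ≤ ∣ q - p ∣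
  p-q≤∣q-p∣ p q = begin
    p - q          ≡⟨ swap p q ⟩
    - (q - p)      ≤⟨ p≤∣p∣ (- (q - p)) ⟩
    ∣ - (q - p) ∣  ≡⟨ ℚ.∣-p∣≡∣p∣ (q - p) ⟩
    ∣ q - p ∣      ∎
    where
    open ≤-Reasoning
    swap : ∀ p q → p - q ≡ - (q - p)
    swap = solve 2 (λ p q → p :- q := :- (q :- p)) λ {_ _} → refl

  p÷₀q*q≡p : ∀ p {q} → q ≢ 0ℚ → (p ÷₀ q) * q ≡ p
  p÷₀q*q≡p p {q} q≢0 with q ℚ.≟ 0ℚ
  ... | yes q≡0 = ⊥-elim (q≢0 q≡0)
  ... | no  q≢0′ = begin
    p * ℚ.1/ q * q     ≡⟨ ℚ.*-assoc p _ q ⟩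
    p * (ℚ.1/ q * q)   ≡⟨ cong (p *_) (ℚ.*-inverseˡ q) ⟩
    p * 1ℚ             ≡⟨ ℚ.*-identityʳ p ⟩
    p                  ∎
    where
    open ≡-Reasoning
    instance
      q-nonZero : ℚ.NonZero q
      q-nonZero = ≢-nonZero q≢0′

  *≡⇒≡÷₀ : ∀ {p q r} → q ≢ 0ℚ → r * q ≡ p → r ≡ p ÷₀ q
  *≡⇒≡÷₀ {p} {q} {r} q≢0 rq≡p with q ℚ.≟ 0ℚ
  ... | yes q≡0 = ⊥-elim (q≢0 q≡0)
  ... | no  q≢0′ = begin
    r                  ≡⟨ sym (ℚ.*-identityʳ r) ⟩
    r * 1ℚ             ≡⟨ cong (r *_) (sym (ℚ.*-inverseʳ q)) ⟩
    r * (q * ℚ.1/ q)   ≡⟨ sym (ℚ.*-assoc r q _) ⟩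
    r * q * ℚ.1/ q     ≡⟨ cong (_* ℚ.1/ q) rq≡p ⟩
    p * ℚ.1/ q         ∎
    where
    open ≡-Reasoning
    instance
      q-nonZero : ℚ.NonZero q
      q-nonZero = ≢-nonZero q≢0′

  *-cancelʳ-≡ : ∀ {p q r} → r ≢ 0ℚ → p * r ≡ q * r → p ≡ q
  *-cancelʳ-≡ r≢0 pr≡qr = trans (*≡⇒≡÷₀ r≢0 pr≡qr) (sym (*≡⇒≡÷₀ r≢0 refl))

  1÷₀-pos : ∀ {q} → 0ℚ < q → 0ℚ < 1ℚ ÷₀ q
  1÷₀-pos {q} 0<q with q ℚ.≟ 0ℚ
  ... | yes q≡0 = ⊥-elim (pos⇒≢0 0<q q≡0)
  ... | no  q≢0 = *-pos {q = (ℚ.1/ q) {{≢-nonZero q≢0}}} (ℚ.positive⁻¹ 1ℚ)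
                        (ℚ.positive⁻¹ _ {{ℚ.1/pos⇒pos q {{ℚ.positive 0<q}}}})

  1÷₀-* : ∀ {p q} → 0ℚ < p → 0ℚ < q → 1ℚ ÷₀ (p * q) ≡ (1ℚ ÷₀ p) * (1ℚ ÷₀ q)
  1÷₀-* {p} {q} 0<p 0<q = sym (*≡⇒≡÷₀ (pos⇒≢0 (*-pos 0<p 0<q)) (begin
    (1ℚ ÷₀ p) * (1ℚ ÷₀ q) * (p * q)
      ≡⟨ interchange-* (1ℚ ÷₀ p) (1ℚ ÷₀ q) p q ⟩
    (1ℚ ÷₀ p) * p * ((1ℚ ÷₀ q) * q)
      ≡⟨ cong₂ _*_ (p÷₀q*q≡p 1ℚ (pos⇒≢0 0<p)) (p÷₀q*q≡p 1ℚ (pos⇒≢0 0<q)) ⟩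
    1ℚ
      ∎))
    where
    open ≡-Reasoning
    interchange-* : ∀ a b c d → a * b * (c * d) ≡ a * c * (b * d)
    interchange-* = solve 4 (λ a b c d → a :* b :* (c :* d) := a :* c :* (b :* d)) λ {_ _ _ _} → refl

  two-point-deviation : ∀ {p q} y z ν → 0ℚ ≤ p → 0ℚ ≤ q →
                        (p ⊓ q) * ∣ y - z ∣ ≤ p * ∣ y - ν ∣ + q * ∣ z - ν ∣
  two-point-deviation {p} {q} y z ν 0≤p 0≤q = begin
    (p ⊓ q) * ∣ y - z ∣
      ≡⟨ cong (λ t → (p ⊓ q) * ∣ t ∣) (difference y z ν) ⟩
    (p ⊓ q) * ∣ (y - ν) - (z - ν) ∣
      ≤⟨ *-monoˡ-≤ (ℚ.⊓-glb 0≤p 0≤q) (ℚ.∣p-q∣≤∣p∣+∣q∣ (y - ν) (z - ν)) ⟩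
    (p ⊓ q) * (∣ y - ν ∣ + ∣ z - ν ∣)
      ≡⟨ ℚ.*-distribˡ-+ (p ⊓ q) ∣ y - ν ∣ ∣ z - ν ∣ ⟩
    (p ⊓ q) * ∣ y - ν ∣ + (p ⊓ q) * ∣ z - ν ∣
      ≤⟨ ℚ.+-mono-≤ (*-monoʳ-≤ (ℚ.0≤∣p∣ _) (ℚ.p⊓q≤p p q))
                    (*-monoʳ-≤ (ℚ.0≤∣p∣ _) (ℚ.p⊓q≤q p q)) ⟩
    p * ∣ y - ν ∣ + q * ∣ z - ν ∣
      ∎
    where
    open ≤-Reasoning
    difference : ∀ y z ν → y - z ≡ (y - ν) - (z - ν)
    difference = solve 3 (λ y z ν → y :- z := (y :- ν) :- (z :- ν)) λ {_ _ _} → refl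

  module _ {A : Set} where

    sumℚ-++ : ∀ (g : A → ℚ) xs ys → sumℚ (map g (xs ++ ys)) ≡ sumℚ (map g xs) + sumℚ (map g ys)
    sumℚ-++ g []       ys = sym (ℚ.+-identityˡ _)
    sumℚ-++ g (y ∷ xs) ys = trans (cong (g y +_) (sumℚ-++ g xs ys)) (sym (ℚ.+-assoc (g y) _ _))

    sumℚ-+ : ∀ (g h : A → ℚ) xs → sumℚ (map (λ y → g y + h y) xs) ≡ sumℚ (map g xs) + sumℚ (map h xs)
    sumℚ-+ g h []       = refl
    sumℚ-+ g h (y ∷ xs) = trans (cong (g y + h y +_) (sumℚ-+ g h xs)) (interchange (g y) (h y) _ _)

    sumℚ-- : ∀ (g h : A → ℚ) xs → sumℚ (map (λ y → g y - h y) xs) ≡ sumℚ (map g xs) - sumℚ (map h xs)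
    sumℚ-- g h []       = refl
    sumℚ-- g h (y ∷ xs) = begin
      (g y - h y) + sumℚ (map (λ y → g y - h y) xs)   ≡⟨ cong (g y - h y +_) (sumℚ-- g h xs) ⟩
      (g y - h y) + (G - H)                           ≡⟨ interchange (g y) (- h y) G (- H) ⟩
      (g y + G) + (- h y - H)                         ≡⟨ cong (g y + G +_) (sym (ℚ.neg-distrib-+ (h y) H)) ⟩
      (g y + G) - (h y + H)                           ∎
      where
      open ≡-Reasoning
      G H : ℚ
      G = sumℚ (map g xs)
      H = sumℚ (map h xs)

    sumℚ-*ˡ : ∀ c (g : A → ℚ) xs → sumℚ (map (λ y → c * g y) xs) ≡ c * sumℚ (map g xs)
    sumℚ-*ˡ c g []       = sym (ℚ.*-zeroʳ c)
    sumℚ-*ˡ c g (y ∷ xs) = trans (cong (c * g y +_) (sumℚ-*ˡ c g xs)) (sym (ℚ.*-distribˡ-+ c (g y) _))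

    sumℚ-const : ∀ c (xs : List A) → sumℚ (map (λ _ → c) xs) ≡ ℕ→ℚ (length xs) * c
    sumℚ-const c []       = sym (ℚ.*-zeroˡ c)
    sumℚ-const c (y ∷ xs) = begin
      c + sumℚ (map (λ _ → c) xs)   ≡⟨ cong₂ _+_ (sym (ℚ.*-identityˡ c)) (sumℚ-const c xs) ⟩
      1ℚ * c + ℕ→ℚ (length xs) * c  ≡⟨ sym (ℚ.*-distribʳ-+ c 1ℚ (ℕ→ℚ (length xs))) ⟩
      (1ℚ + ℕ→ℚ (length xs)) * c    ≡⟨ cong (_* c) (sym (ℕ→ℚ-+ 1 (length xs))) ⟩
      ℕ→ℚ (suc (length xs)) * c     ∎
      where open ≡-Reasoning

    sumℚ-zeros : ∀ (xs : List A) → sumℚ (map (λ _ → 0ℚ) xs) ≡ 0ℚ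
    sumℚ-zeros []       = refl
    sumℚ-zeros (y ∷ xs) = trans (ℚ.+-identityˡ _) (sumℚ-zeros xs)

    sumℚ-mono-≤ : ∀ {g h : A → ℚ} → (∀ y → g y ≤ h y) → ∀ xs → sumℚ (map g xs) ≤ sumℚ (map h xs)
    sumℚ-mono-≤ g≤h []       = ≤-refl
    sumℚ-mono-≤ g≤h (y ∷ xs) = ℚ.+-mono-≤ (g≤h y) (sumℚ-mono-≤ g≤h xs)

  sumℚ-allFin-const : ∀ {n} c → sumℚ (map (λ (_ : Fin n) → c) (allFin n)) ≡ ℕ→ℚ n * c
  sumℚ-allFin-const {n} c =
    trans (sumℚ-const c (allFin n)) (cong (λ m → ℕ→ℚ m * c) (List.length-tabulate {n = n} id))

  sumℚ-allFin-suc : ∀ {m} (h : Fin (suc m) → ℚ) →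
                    sumℚ (map h (allFin (suc m))) ≡ h Fin.zero + sumℚ (map (h ∘ Fin.suc) (allFin m))
  sumℚ-allFin-suc h = cong (λ hs → h Fin.zero + sumℚ hs)
    (trans (List.map-tabulate Fin.suc h) (sym (List.map-tabulate id (h ∘ Fin.suc))))

  indicator : ∀ {m} → Fin m → ℚ → Fin m → ℚ
  indicator i c j = if does (i Fin.≟ j) then c else 0ℚ

  sumℚ-indicator : ∀ {m} (i : Fin m) c → sumℚ (map (indicator i c) (allFin m)) ≡ c
  sumℚ-indicator {suc m} Fin.zero c = begin
    sumℚ (map (indicator Fin.zero c) (allFin (suc m)))     ≡⟨ sumℚ-allFin-suc {m} (indicator Fin.zero c) ⟩
    c + sumℚ (map (λ _ → 0ℚ) (allFin m))                  ≡⟨ cong (c +_) (sumℚ-zeros (allFin m)) ⟩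
    c + 0ℚ                                                 ≡⟨ ℚ.+-identityʳ c ⟩
    c                                                      ∎
    where open ≡-Reasoning
  sumℚ-indicator {suc m} (Fin.suc i) c = begin
    sumℚ (map (indicator (Fin.suc i) c) (allFin (suc m)))  ≡⟨ sumℚ-allFin-suc {m} (indicator (Fin.suc i) c) ⟩
    0ℚ + sumℚ (map (indicator i c) (allFin m))             ≡⟨ ℚ.+-identityˡ _ ⟩
    sumℚ (map (indicator i c) (allFin m))                  ≡⟨ sumℚ-indicator i c ⟩
    c                                                      ∎
    where open ≡-Reasoning

  sumℚ-allFin-≥ : ∀ {m} (g : Fin m → ℚ) → (∀ j → 0ℚ ≤ g j) → ∀ i → g i ≤ sumℚ (map g (allFin m))
  sumℚ-allFin-≥ {m} g 0≤g i = begin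
    g i                                         ≡⟨ sym (sumℚ-indicator i (g i)) ⟩
    sumℚ (map (indicator i (g i)) (allFin m))   ≤⟨ sumℚ-mono-≤ below (allFin m) ⟩
    sumℚ (map g (allFin m))                     ∎
    where
    open ≤-Reasoning
    below : ∀ j → indicator i (g i) j ≤ g j
    below j with i Fin.≟ j
    ... | yes refl = ≤-refl
    ... | no  _    = 0≤g j

  module _ {A : Set} {m : ℕ} (P : A → Fin m) where

    fibre : Fin m → List A → List A
    fibre j = filter (λ y → P y Fin.≟ j)

    private
      sumℚ-fibre-∷ : ∀ (g : A → ℚ) y xs j →
                     sumℚ (map g (fibre j (y ∷ xs))) ≡ indicator (P y) (g y) j + sumℚ (map g (fibre j xs))
      sumℚ-fibre-∷ g y xs j with does (P y Fin.≟ j)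
      ... | true  = refl
      ... | false = sym (ℚ.+-identityˡ _)

    sumℚ-fibres : ∀ (g : A → ℚ) xs →
                  sumℚ (map (λ j → sumℚ (map g (fibre j xs))) (allFin m)) ≡ sumℚ (map g xs)
    sumℚ-fibres g []       = sumℚ-zeros (allFin m)
    sumℚ-fibres g (y ∷ xs) = begin
      sumℚ (map (λ j → sumℚ (map g (fibre j (y ∷ xs)))) (allFin m))
        ≡⟨ cong sumℚ (List.map-cong (sumℚ-fibre-∷ g y xs) (allFin m)) ⟩
      sumℚ (map (λ j → indicator (P y) (g y) j + Σfibre j) (allFin m))
        ≡⟨ sumℚ-+ (indicator (P y) (g y)) Σfibre (allFin m) ⟩
      sumℚ (map (indicator (P y) (g y)) (allFin m)) + sumℚ (map Σfibre (allFin m))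
        ≡⟨ cong₂ _+_ (sumℚ-indicator (P y) (g y)) (sumℚ-fibres g xs) ⟩
      g y + sumℚ (map g xs)
        ∎
      where
      open ≡-Reasoning
      Σfibre : Fin m → ℚ
      Σfibre j = sumℚ (map g (fibre j xs))

  balanced-share-≥ : ∀ {n} (w : Fin n → ℚ) {ρ} → 0ℚ ≤ ρ → (∀ i → 0ℚ < w i) →
                     (∀ i j → w i ≤ (1ℚ + ρ) * w j) →
                     ∀ i → 1 - ρ ≤ ℕ→ℚ n * (w i ÷₀ sumℚ (map w (allFin n)))
  balanced-share-≥ {n} w {ρ} 0≤ρ 0<w balanced i = *-cancelʳ-≤ 0<S (begin
    (1 - ρ) * S
      ≤⟨ *-cancelˡ-≤ 0<1+ρ (≤-trans (≤-by-slack (ρ * ρ * S) 0≤ρρS (squares ρ S)) S≤) ⟩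
    N * w i
      ≡⟨ cong (N *_) (sym (p÷₀q*q≡p (w i) (pos⇒≢0 0<S))) ⟩
    N * ((w i ÷₀ S) * S)
      ≡⟨ sym (ℚ.*-assoc N _ S) ⟩
    N * (w i ÷₀ S) * S
      ∎)
    where
    open ≤-Reasoning
    N S : ℚ
    N = ℕ→ℚ n
    S = sumℚ (map w (allFin n))
    0<N : 0ℚ < N
    0<N = ℕ→ℚ-mono-< (ℕ.≤-<-trans ℕ.z≤n (Fin.toℕ<n i))
    0<1+ρ : 0ℚ < 1ℚ + ρ
    0<1+ρ = ℚ.<-≤-trans (ℚ.positive⁻¹ 1ℚ) (≤-by-slack ρ 0≤ρ refl)
    S≤ : S ≤ (1ℚ + ρ) * (N * w i)
    S≤ = begin
      S                                             ≤⟨ sumℚ-mono-≤ (λ j → balanced j i) (allFin n) ⟩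
      sumℚ (map (λ _ → (1ℚ + ρ) * w i) (allFin n))  ≡⟨ sumℚ-allFin-const {n} ((1ℚ + ρ) * w i) ⟩
      N * ((1ℚ + ρ) * w i)                          ≡⟨ ℚ.*-comm N _ ⟩
      (1ℚ + ρ) * w i * N                            ≡⟨ ℚ.*-assoc (1ℚ + ρ) (w i) N ⟩
      (1ℚ + ρ) * (w i * N)                          ≡⟨ cong ((1ℚ + ρ) *_) (ℚ.*-comm (w i) N) ⟩
      (1ℚ + ρ) * (N * w i)                          ∎
    Nw≤ : N * w i ≤ (1ℚ + ρ) * S
    Nw≤ = begin
      N * w i                                       ≡⟨ sym (sumℚ-allFin-const {n} (w i)) ⟩
      sumℚ (map (λ _ → w i) (allFin n))             ≤⟨ sumℚ-mono-≤ (balanced i) (allFin n) ⟩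
      sumℚ (map (λ j → (1ℚ + ρ) * w j) (allFin n))  ≡⟨ sumℚ-*ˡ (1ℚ + ρ) w (allFin n) ⟩
      (1ℚ + ρ) * S                                  ∎
    0<S : 0ℚ < S
    0<S = ℚ.*-cancelˡ-<-nonNeg (1ℚ + ρ) {{ℚ.nonNegative (ℚ.<⇒≤ 0<1+ρ)}}
            (ℚ.<-≤-trans (subst (_< N * w i) (sym (ℚ.*-zeroʳ (1ℚ + ρ))) (*-pos 0<N (0<w i))) Nw≤)
    0≤ρρS : 0ℚ ≤ ρ * ρ * S
    0≤ρρS = *-nonNeg (*-nonNeg 0≤ρ 0≤ρ) (ℚ.<⇒≤ 0<S)
    squares : ∀ ρ S → S ≡ (1ℚ + ρ) * ((1 - ρ) * S) + ρ * ρ * S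
    squares = solve 2 (λ ρ S → S := (con 1ℚ :+ ρ) :* ((con 1 :- ρ) :* S) :+ ρ :* ρ :* S) λ {_ _} → refl

  private
    cast : ∀ {m n p q} → m ℕ.≤ n → ℕ→ℚ m ≡ p → ℕ→ℚ n ≡ q → p ≤ q
    cast m≤n refl refl = ℕ→ℚ-mono-≤ m≤n

    cast-above : ∀ β A B C → β ℕ.+ (B ℕ.+ C) ℕ.≤ 2 ℕ.* A →
                 ℕ→ℚ β + (ℕ→ℚ B + ℕ→ℚ C) ≤ 2 * ℕ→ℚ A
    cast-above β A B C above =
      cast above (trans (ℕ→ℚ-+ β (B ℕ.+ C)) (cong (ℕ→ℚ β +_) (ℕ→ℚ-+ B C))) (ℕ→ℚ-* 2 A)

    cast-spread₁ : ∀ β A B C → β ℕ.+ 4 ℕ.* A ℕ.≤ 2 ℕ.* B ℕ.+ 3 ℕ.* C →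
                   ℕ→ℚ β + 4 * ℕ→ℚ A ≤ 2 * ℕ→ℚ B + 3 * ℕ→ℚ C
    cast-spread₁ β A B C spread =
      cast spread (trans (ℕ→ℚ-+ β (4 ℕ.* A)) (cong (ℕ→ℚ β +_) (ℕ→ℚ-* 4 A)))
                  (trans (ℕ→ℚ-+ (2 ℕ.* B) (3 ℕ.* C)) (cong₂ _+_ (ℕ→ℚ-* 2 B) (ℕ→ℚ-* 3 C)))

    cast-spread₂ : ∀ β A B C → β ℕ.+ 2 ℕ.* A ℕ.≤ 4 ℕ.* B ℕ.+ C →
                   ℕ→ℚ β + 2 * ℕ→ℚ A ≤ 4 * ℕ→ℚ B + ℕ→ℚ C
    cast-spread₂ β A B C spread =
      cast spread (trans (ℕ→ℚ-+ β (2 ℕ.* A)) (cong (ℕ→ℚ β +_) (ℕ→ℚ-* 2 A)))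
                  (trans (ℕ→ℚ-+ (4 ℕ.* B) C) (cong (_+ ℕ→ℚ C) (ℕ→ℚ-* 4 B)))

  above-or-spreadℚ : ∀ A B C →
                     let a = ℕ→ℚ A; b = ℕ→ℚ B; c = ℕ→ℚ C; β = ℕ→ℚ (irregularity (A , B , C)) in
                     β + (b + c) ≤ 2 * a ⊎ (β + 4 * a ≤ 2 * b + 3 * c × β + 2 * a ≤ 4 * b + c)
  above-or-spreadℚ A B C =
    Sum.map (cast-above β A B C) (Product.map (cast-spread₁ β A B C) (cast-spread₂ β A B C))
            (above-or-spread A B C)
    where
    β : ℕ
    β = irregularity (A , B , C)

  module _ {n : ℕ} where

    xIndices x′Indices x″Indices : List (Elem n) → List (Fin n)
    xIndices []             = []
    xIndices (x i ∷ es)     = i ∷ xIndices es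
    xIndices (x′ _ ∷ es)    = xIndices es
    xIndices (x″ _ ∷ es)    = xIndices es
    x′Indices []            = []
    x′Indices (x _ ∷ es)    = x′Indices es
    x′Indices (x′ i ∷ es)   = i ∷ x′Indices es
    x′Indices (x″ _ ∷ es)   = x′Indices es
    x″Indices []            = []
    x″Indices (x _ ∷ es)    = x″Indices es
    x″Indices (x′ _ ∷ es)   = x″Indices es
    x″Indices (x″ i ∷ es)   = i ∷ x″Indices es

    private
      absorb₁ : ∀ p q r s → p + (q + r + s) ≡ p + q + r + s
      absorb₁ = solve 4 (λ p q r s → p :+ (q :+ r :+ s) := p :+ q :+ r :+ s) λ {_ _ _ _} → refl
      absorb₂ : ∀ p q r s → p + (q + r + s) ≡ q + (p + r) + s
      absorb₂ = solve 4 (λ p q r s → p :+ (q :+ r :+ s) := q :+ (p :+ r) :+ s) λ {_ _ _ _} → refl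
      absorb₃ : ∀ p q r s → p + (q + r + s) ≡ q + r + (p + s)
      absorb₃ = solve 4 (λ p q r s → p :+ (q :+ r :+ s) := q :+ r :+ (p :+ s)) λ {_ _ _ _} → refl

    sumℚ-by-kind : ∀ (g : Elem n → ℚ) X →
                   sumℚ (map g X) ≡ sumℚ (map (g ∘ x) (xIndices X)) + sumℚ (map (g ∘ x′) (x′Indices X))
                                    + sumℚ (map (g ∘ x″) (x″Indices X))
    sumℚ-by-kind g []      = refl
    sumℚ-by-kind g (e ∷ X) = trans (cong (g e +_) (sumℚ-by-kind g X)) (insert e)
      where
      Σx Σx′ Σx″ : ℚ
      Σx  = sumℚ (map (g ∘ x) (xIndices X))
      Σx′ = sumℚ (map (g ∘ x′) (x′Indices X))
      Σx″ = sumℚ (map (g ∘ x″) (x″Indices X))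
      insert : ∀ e → g e + (Σx + Σx′ + Σx″) ≡ sumℚ (map (g ∘ x) (xIndices (e ∷ X)))
                                              + sumℚ (map (g ∘ x′) (x′Indices (e ∷ X)))
                                              + sumℚ (map (g ∘ x″) (x″Indices (e ∷ X)))
      insert (x i)  = absorb₁ (g (x i)) Σx Σx′ Σx″
      insert (x′ i) = absorb₂ (g (x′ i)) Σx Σx′ Σx″
      insert (x″ i) = absorb₃ (g (x″ i)) Σx Σx′ Σx″

    sumℚ-by-count : ∀ (g : Elem n → ℚ) p q r →
                    (∀ i → g (x i) ≡ p) → (∀ i → g (x′ i) ≡ q) → (∀ i → g (x″ i) ≡ r) → ∀ X →
                    sumℚ (map g X) ≡ ℕ→ℚ (length (xIndices X)) * p + ℕ→ℚ (length (x′Indices X)) * q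
                                     + ℕ→ℚ (length (x″Indices X)) * r
    sumℚ-by-count g p q r gx gx′ gx″ X = trans (sumℚ-by-kind g X)
      (cong₂ _+_ (cong₂ _+_ (constant p gx (xIndices X)) (constant q gx′ (x′Indices X)))
                 (constant r gx″ (x″Indices X)))
      where
      constant : ∀ {kind : Fin n → Elem n} c → (∀ i → g (kind i) ≡ c) → ∀ is →
                 sumℚ (map (g ∘ kind) is) ≡ ℕ→ℚ (length is) * c
      constant c g≡c is = trans (cong sumℚ (List.map-cong g≡c is)) (sumℚ-const c is)

    sumℚ-allElems : ∀ (g : Elem n → ℚ) →
                    sumℚ (map g (allElems n)) ≡ sumℚ (map (g ∘ x) (allFin n))
                                                + (sumℚ (map (g ∘ x′) (allFin n)) + sumℚ (map (g ∘ x″) (allFin n)))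
    sumℚ-allElems g = begin
      sumℚ (map g (allElems n))
        ≡⟨ sumℚ-++ g (map x (allFin n)) _ ⟩
      sumℚ (map g (map x (allFin n))) + sumℚ (map g (map x′ (allFin n) ++ map x″ (allFin n)))
        ≡⟨ cong (sumℚ (map g (map x (allFin n))) +_) (sumℚ-++ g (map x′ (allFin n)) _) ⟩
      sumℚ (map g (map x (allFin n))) + (sumℚ (map g (map x′ (allFin n))) + sumℚ (map g (map x″ (allFin n))))
        ≡⟨ sym (cong₂ _+_ (along x) (cong₂ _+_ (along x′) (along x″))) ⟩
      sumℚ (map (g ∘ x) (allFin n)) + (sumℚ (map (g ∘ x′) (allFin n)) + sumℚ (map (g ∘ x″) (allFin n)))
        ∎
      where
      open ≡-Reasoning
      along : (kind : Fin n → Elem n) → sumℚ (map (g ∘ kind) (allFin n)) ≡ sumℚ (map g (map kind (allFin n)))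
      along kind = cong sumℚ (List.map-∘ (allFin n))

  module _ (k : ℕ) (weight : Fin (2 ℕ.* k) → ℕ) where
    open Instance k weight

    signature-counts : ∀ X → signature X ≡ (length (xIndices X) , length (x′Indices X) , length (x″Indices X))
    signature-counts []         = refl
    signature-counts (x _ ∷ X)  with signature X | signature-counts X
    ... | _ | refl = refl
    signature-counts (x′ _ ∷ X) with signature X | signature-counts X
    ... | _ | refl = refl
    signature-counts (x″ _ ∷ X) with signature X | signature-counts X
    ... | _ | refl = refl

    irregular-part : ∀ {m} (P : Elem n → Fin m) → ¬ Regular P → ∃[ j ] ¬ RegularShape (signature (part P j))
    irregular-part {m} P ¬regular =
      Fin.¬∀⟶∃¬ m _ (λ j → regularShape? (signature (part P j))) (λ regular → ¬regular (λ j _ → regular j))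

    -- the mass Dx e of every point
    W : ℚ
    W = 1ℚ ÷₀ ℕ→ℚ (3 ℕ.* n)

    module CostBound (u ρ : ℚ) (0≤u : 0ℚ ≤ u) (0≤ρ : 0ℚ ≤ ρ) (0<W : 0ℚ < W) (ε≡2u : ε ≡ 2 * u)
                     (δ≡3u : δ ≡ 3 * u) (εᵢ-lower : ∀ i → 6 * u * (1 - ρ) ≤ εᵢ i) where

      mean : ∀ X → ℕ→ℚ (length X) * μSet X ≡ sumℚ (map μ X)
      mean []           = ℚ.*-zeroˡ (μSet [])
      mean X@(_ ∷ rest) = *-cancelʳ-≡ (pos⇒≢0 0<W) (begin
        N * ν * W                         ≡⟨ reassociate N ν W ⟩
        ν * (N * W)                       ≡⟨ cong (ν *_) (sym (sumℚ-const W X)) ⟩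
        ν * sumℚ (map Dx X)               ≡⟨ p÷₀q*q≡p _ ΣDx≢0 ⟩
        sumℚ (map (λ e → Dx e * μ e) X)   ≡⟨ sumℚ-*ˡ W μ X ⟩
        W * sumℚ (map μ X)                ≡⟨ ℚ.*-comm W _ ⟩
        sumℚ (map μ X) * W                ∎)
        where
        open ≡-Reasoning
        N ν : ℚ
        N = ℕ→ℚ (length X)
        ν = μSet X
        ΣDx≢0 : sumℚ (map Dx X) ≢ 0ℚ
        ΣDx≢0 = pos⇒≢0 (subst (0ℚ <_) (sym (sumℚ-const W X)) (*-pos (ℕ→ℚ-pos (length rest)) 0<W))
        reassociate : ∀ N ν W → N * ν * W ≡ ν * (N * W)
        reassociate = solve 3 (λ N ν W → N :* ν :* W := ν :* (N :* W)) λ {_ _ _} → refl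

      ω : Elem n → ℚ
      ω (x _)  = 4 - 6 * ρ
      ω (x′ _) = - 2
      ω (x″ _) = - 1

      module Part (X : List (Elem n)) where

        A B C : ℕ
        A = length (xIndices X)
        B = length (x′Indices X)
        C = length (x″Indices X)

        a b c ν deviation : ℚ
        a = ℕ→ℚ A
        b = ℕ→ℚ B
        c = ℕ→ℚ C
        ν = μSet X
        deviation = sumℚ (map (λ e → ∣ f e - ν ∣) X)

        sumℚ-ω : sumℚ (map ω X) ≡ a * (4 - 6 * ρ) + b * (- 2) + c * (- 1)
        sumℚ-ω = sumℚ-by-count ω (4 - 6 * ρ) (- 2) (- 1) (λ _ → refl) (λ _ → refl) (λ _ → refl) X

        deviation-by-kind : deviation ≡ (a + b) * ∣ ½ - ν ∣ + c * ∣ (½ + ε) - ν ∣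
        deviation-by-kind = trans
          (sumℚ-by-count (λ e → ∣ f e - ν ∣) (∣ ½ - ν ∣) (∣ ½ - ν ∣) (∣ (½ + ε) - ν ∣)
                         (λ _ → refl) (λ _ → refl) (λ _ → refl) X)
          (cong (_+ c * ∣ (½ + ε) - ν ∣) (sym (ℚ.*-distribʳ-+ ∣ ½ - ν ∣ a b)))

        excess-by-kind : sumℚ (map (λ e → μ e - f e) X) ≡ sumℚ (map (λ i → (½ + εᵢ i) - ½) (xIndices X))
                                                          + b * ((½ - δ) - ½) + c * (½ - (½ + ε))
        excess-by-kind = trans (sumℚ-by-kind (λ e → μ e - f e) X)
          (cong₂ _+_ (cong (sumℚ (map (λ i → (½ + εᵢ i) - ½) (xIndices X)) +_)
                           (sumℚ-const ((½ - δ) - ½) (x′Indices X)))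
                     (sumℚ-const (½ - (½ + ε)) (x″Indices X)))

        excess≤deviation : sumℚ (map (λ e → μ e - f e) X) ≤ deviation
        excess≤deviation = begin
          sumℚ (map (λ e → μ e - f e) X)   ≡⟨ sumℚ-- μ f X ⟩
          sumℚ (map μ X) - Σf              ≡⟨ cong (_- Σf) (sym (mean X)) ⟩
          ℕ→ℚ (length X) * ν - Σf          ≡⟨ cong (_- Σf) (sym (sumℚ-const ν X)) ⟩
          sumℚ (map (λ _ → ν) X) - Σf      ≡⟨ sym (sumℚ-- (λ _ → ν) f X) ⟩
          sumℚ (map (λ e → ν - f e) X)     ≤⟨ sumℚ-mono-≤ (λ e → p-q≤∣q-p∣ ν (f e)) X ⟩
          deviation                        ∎
          where
          open ≤-Reasoning
          Σf : ℚ
          Σf = sumℚ (map f X)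

        x-excess : a * (6 * u * (1 - ρ)) ≤ sumℚ (map (λ i → (½ + εᵢ i) - ½) (xIndices X))
        x-excess = begin
          a * (6 * u * (1 - ρ))                             ≡⟨ sym (sumℚ-const (6 * u * (1 - ρ)) (xIndices X)) ⟩
          sumℚ (map (λ _ → 6 * u * (1 - ρ)) (xIndices X))   ≤⟨ sumℚ-mono-≤ lower (xIndices X) ⟩
          sumℚ (map (λ i → (½ + εᵢ i) - ½) (xIndices X))    ∎
          where
          open ≤-Reasoning
          ½+p-½≡p : ∀ p → (½ + p) - ½ ≡ p
          ½+p-½≡p = solve 1 (λ p → (con ½ :+ p) :- con ½ := p) λ {_} → refl
          lower : ∀ i → 6 * u * (1 - ρ) ≤ (½ + εᵢ i) - ½
          lower i = subst (6 * u * (1 - ρ) ≤_) (sym (½+p-½≡p (εᵢ i))) (εᵢ-lower i)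

        bound-above : ∀ t → t + (b + c) ≤ 2 * a → u * (sumℚ (map ω X) + t) ≤ deviation
        bound-above t above = begin
          u * (sumℚ (map ω X) + t)
            ≡⟨ cong (λ s → u * (s + t)) sumℚ-ω ⟩
          u * (a * (4 - 6 * ρ) + b * (- 2) + c * (- 1) + t)
            ≤⟨ ≤-by-slack _ (*-nonNeg 0≤u (p≤q⇒0≤q-p above)) (slack a b c t u ρ) ⟩
          a * (6 * u * (1 - ρ)) + b * ((½ - 3 * u) - ½) + c * (½ - (½ + 2 * u))
            ≡⟨ cong₂ (λ d e → a * (6 * u * (1 - ρ)) + b * ((½ - d) - ½) + c * (½ - (½ + e)))
                     (sym δ≡3u) (sym ε≡2u) ⟩
          a * (6 * u * (1 - ρ)) + b * ((½ - δ) - ½) + c * (½ - (½ + ε))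
            ≤⟨ ℚ.+-monoˡ-≤ _ (ℚ.+-monoˡ-≤ _ x-excess) ⟩
          sumℚ (map (λ i → (½ + εᵢ i) - ½) (xIndices X)) + b * ((½ - δ) - ½) + c * (½ - (½ + ε))
            ≡⟨ sym excess-by-kind ⟩
          sumℚ (map (λ e → μ e - f e) X)
            ≤⟨ excess≤deviation ⟩
          deviation
            ∎
          where
          open ≤-Reasoning
          slack : ∀ a b c t u ρ →
                  a * (6 * u * (1 - ρ)) + b * ((½ - 3 * u) - ½) + c * (½ - (½ + 2 * u)) ≡
                  u * (a * (4 - 6 * ρ) + b * (- 2) + c * (- 1) + t) + u * (2 * a - (t + (b + c)))
          slack = solve 6 (λ a b c t u ρ →
            a :* (con 6 :* u :* (con 1 :- ρ)) :+ b :* ((con ½ :- con 3 :* u) :- con ½)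
              :+ c :* (con ½ :- (con ½ :+ con 2 :* u)) :=
            u :* (a :* (con 4 :- con 6 :* ρ) :+ b :* (:- con 2) :+ c :* (:- con 1) :+ t)
              :+ u :* (con 2 :* a :- (t :+ (b :+ c))))
            λ {_ _ _ _ _ _} → refl

        bound-spread : ∀ t → t + 4 * a ≤ 2 * b + 3 * c → t + 2 * a ≤ 4 * b + c →
                       u * (sumℚ (map ω X) + t) ≤ deviation
        bound-spread t spread₁ spread₂ = begin
          u * (sumℚ (map ω X) + t)
            ≡⟨ cong (λ s → u * (s + t)) sumℚ-ω ⟩
          u * (a * (4 - 6 * ρ) + b * (- 2) + c * (- 1) + t)
            ≤⟨ *-monoˡ-≤ 0≤u (≤-trans (≤-by-slack (6 * ρ * a) 0≤6ρa (drop-ρ a b c t ρ)) spread-⊓) ⟩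
          u * (2 * ((a + b) ⊓ c))
            ≡⟨ gap ⟩
          ((a + b) ⊓ c) * ∣ ½ - (½ + ε) ∣
            ≤⟨ two-point-deviation {a + b} {c} ½ (½ + ε) ν 0≤a+b (ℕ→ℚ-nonNeg C) ⟩
          (a + b) * ∣ ½ - ν ∣ + c * ∣ (½ + ε) - ν ∣
            ≡⟨ sym deviation-by-kind ⟩
          deviation
            ∎
          where
          open ≤-Reasoning
          0≤a+b : 0ℚ ≤ a + b
          0≤a+b = subst (0ℚ ≤_) (ℕ→ℚ-+ A B) (ℕ→ℚ-nonNeg (A ℕ.+ B))
          0≤6ρa : 0ℚ ≤ 6 * ρ * a
          0≤6ρa = *-nonNeg (*-nonNeg (ℕ→ℚ-nonNeg 6) 0≤ρ) (ℕ→ℚ-nonNeg A)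
          drop-ρ : ∀ a b c t ρ →
                   t + 4 * a - 2 * b - c ≡ a * (4 - 6 * ρ) + b * (- 2) + c * (- 1) + t + 6 * ρ * a
          drop-ρ = solve 5 (λ a b c t ρ →
            t :+ con 4 :* a :- con 2 :* b :- c :=
            a :* (con 4 :- con 6 :* ρ) :+ b :* (:- con 2) :+ c :* (:- con 1) :+ t :+ con 6 :* ρ :* a)
            λ {_ _ _ _ _} → refl
          spread-⊓ : t + 4 * a - 2 * b - c ≤ 2 * ((a + b) ⊓ c)
          spread-⊓ = begin
            t + 4 * a - 2 * b - c
              ≤⟨ ℚ.⊓-glb (≤-by-slack _ (p≤q⇒0≤q-p spread₂) (slack₂ a b c t))
                         (≤-by-slack _ (p≤q⇒0≤q-p spread₁) (slack₁ a b c t)) ⟩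
            (2 * (a + b)) ⊓ (2 * c)
              ≡⟨ sym (ℚ.mono-≤-distrib-⊓ (*-monoˡ-≤ (ℕ→ℚ-nonNeg 2)) (a + b) c) ⟩
            2 * ((a + b) ⊓ c)
              ∎
            where
            slack₁ : ∀ a b c t → 2 * c ≡ t + 4 * a - 2 * b - c + ((2 * b + 3 * c) - (t + 4 * a))
            slack₁ = solve 4 (λ a b c t →
              con 2 :* c :=
              t :+ con 4 :* a :- con 2 :* b :- c :+ ((con 2 :* b :+ con 3 :* c) :- (t :+ con 4 :* a)))
              λ {_ _ _ _} → refl
            slack₂ : ∀ a b c t → 2 * (a + b) ≡ t + 4 * a - 2 * b - c + ((4 * b + c) - (t + 2 * a))
            slack₂ = solve 4 (λ a b c t →
              con 2 :* (a :+ b) :=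
              t :+ con 4 :* a :- con 2 :* b :- c :+ ((con 4 :* b :+ c) :- (t :+ con 2 :* a)))
              λ {_ _ _ _} → refl
          ε-gap : ∣ ½ - (½ + ε) ∣ ≡ 2 * u
          ε-gap = begin-equality
            ∣ ½ - (½ + ε) ∣   ≡⟨ cong ∣_∣ (½-½+p≡-p ε) ⟩
            ∣ - ε ∣           ≡⟨ ℚ.∣-p∣≡∣p∣ ε ⟩
            ∣ ε ∣             ≡⟨ ℚ.0≤p⇒∣p∣≡p 0≤ε ⟩
            ε                 ≡⟨ ε≡2u ⟩
            2 * u             ∎
            where
            0≤ε : 0ℚ ≤ ε
            0≤ε = subst (0ℚ ≤_) (sym ε≡2u) (*-nonNeg (ℕ→ℚ-nonNeg 2) 0≤u)
            ½-½+p≡-p : ∀ p → ½ - (½ + p) ≡ - p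
            ½-½+p≡-p = solve 1 (λ p → con ½ :- (con ½ :+ p) := :- p) λ {_} → refl
          gap : u * (2 * ((a + b) ⊓ c)) ≡ ((a + b) ⊓ c) * ∣ ½ - (½ + ε) ∣
          gap = trans (swap u ((a + b) ⊓ c)) (cong (((a + b) ⊓ c) *_) (sym ε-gap))
            where
            swap : ∀ u m → u * (2 * m) ≡ m * (2 * u)
            swap = solve 2 (λ u m → u :* (con 2 :* m) := m :* (con 2 :* u)) λ {_ _} → refl

        deviation-bound : u * (sumℚ (map ω X) + ℕ→ℚ (irregularity (signature X))) ≤ deviation
        deviation-bound = subst (λ s → u * (sumℚ (map ω X) + ℕ→ℚ (irregularity s)) ≤ deviation)
          (sym (signature-counts X))
          (Sum.[ bound-above β , uncurry (bound-spread β) ]′ (above-or-spreadℚ A B C))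
          where
          β : ℚ
          β = ℕ→ℚ (irregularity (A , B , C))

      part-cost-bound : ∀ X → W * (u * (sumℚ (map ω X) + ℕ→ℚ (irregularity (signature X)))) ≤ costSet X
      part-cost-bound X = begin
        W * (u * (sumℚ (map ω X) + ℕ→ℚ (irregularity (signature X))))
          ≤⟨ *-monoˡ-≤ (ℚ.<⇒≤ 0<W) (Part.deviation-bound X) ⟩
        W * Part.deviation X
          ≡⟨ sym (sumℚ-*ˡ W (λ e → ∣ f e - μSet X ∣) X) ⟩
        costSet X
          ∎
        where open ≤-Reasoning

      sumℚ-ω-allElems : sumℚ (map ω (allElems n)) ≡ ℕ→ℚ n * (1 - 6 * ρ)
      sumℚ-ω-allElems = begin
        sumℚ (map ω (allElems n))
          ≡⟨ sumℚ-allElems ω ⟩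
        sumℚ (map (λ _ → 4 - 6 * ρ) (allFin n))
          + (sumℚ (map (λ _ → - 2) (allFin n)) + sumℚ (map (λ _ → - 1) (allFin n)))
          ≡⟨ cong₂ _+_ (sumℚ-allFin-const {n} (4 - 6 * ρ))
                       (cong₂ _+_ (sumℚ-allFin-const {n} (- 2)) (sumℚ-allFin-const {n} (- 1))) ⟩
        N * (4 - 6 * ρ) + (N * (- 2) + N * (- 1))
          ≡⟨ collect N ρ ⟩
        N * (1 - 6 * ρ)
          ∎
        where
        open ≡-Reasoning
        N : ℚ
        N = ℕ→ℚ n
        collect : ∀ N ρ → N * (4 - 6 * ρ) + (N * (- 2) + N * (- 1)) ≡ N * (1 - 6 * ρ)
        collect = solve 2 (λ N ρ → N :* (con 4 :- con 6 :* ρ) :+ (N :* (:- con 2) :+ N :* (:- con 1)) :=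
                                   N :* (con 1 :- con 6 :* ρ)) λ {_ _} → refl

      cost-bound : ∀ {m} (P : Elem n → Fin m) → ¬ Regular P → W * (u * (ℕ→ℚ n * (1 - 6 * ρ) + 1)) ≤ cost P
      cost-bound {m} P ¬regular = begin
        W * (u * (ℕ→ℚ n * (1 - 6 * ρ) + 1))
          ≤⟨ *-monoˡ-≤ (ℚ.<⇒≤ 0<W)
               (*-monoˡ-≤ 0≤u (ℚ.+-mono-≤ (≤-reflexive (sym sumℚ-ω-allElems)) Σβ≥1)) ⟩
        W * (u * (sumℚ (map ω (allElems n)) + sumℚ (map β (allFin m))))
          ≡⟨ cong (λ s → W * (u * (s + sumℚ (map β (allFin m))))) (sym (sumℚ-fibres P ω (allElems n))) ⟩
        W * (u * (sumℚ (map Σω (allFin m)) + sumℚ (map β (allFin m))))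
          ≡⟨ cong (λ s → W * (u * s)) (sym (sumℚ-+ Σω β (allFin m))) ⟩
        W * (u * sumℚ (map (λ j → Σω j + β j) (allFin m)))
          ≡⟨ cong (W *_) (sym (sumℚ-*ˡ u (λ j → Σω j + β j) (allFin m))) ⟩
        W * sumℚ (map (λ j → u * (Σω j + β j)) (allFin m))
          ≡⟨ sym (sumℚ-*ˡ W (λ j → u * (Σω j + β j)) (allFin m)) ⟩
        sumℚ (map (λ j → W * (u * (Σω j + β j))) (allFin m))
          ≤⟨ sumℚ-mono-≤ (λ j → part-cost-bound (part P j)) (allFin m) ⟩
        cost P
          ∎
        where
        open ≤-Reasoning
        Σω β : Fin m → ℚ
        Σω j = sumℚ (map ω (part P j))
        β  j = ℕ→ℚ (irregularity (signature (part P j)))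
        Σβ≥1 : 1 ≤ sumℚ (map β (allFin m))
        Σβ≥1 = ≤-trans (≤-reflexive (cong ℕ→ℚ (sym (irregularity-≡1 _ (proj₂ irregular)))))
                       (sumℚ-allFin-≥ β (λ j → ℕ→ℚ-nonNeg (irregularity (signature (part P j))))
                                      (proj₁ irregular))
          where
          irregular : ∃[ j ] ¬ RegularShape (signature (part P j))
          irregular = irregular-part P ¬regular

  ⅟ : ℕ → ℚ
  ⅟ c = 1ℚ ÷₀ ℕ→ℚ c

  module Units (k : ℕ) (0<k : 0 ℕ.< k) where

    private
      K κ : ℚ
      K = ℕ→ℚ k
      κ = ⅟ k

      0<K : 0ℚ < K
      0<K = ℕ→ℚ-mono-< 0<k

      κK≡1 : κ * K ≡ 1ℚ
      κK≡1 = p÷₀q*q≡p 1ℚ (pos⇒≢0 0<K)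

      0<suc : ∀ {c} → 0 ℕ.< suc c
      0<suc = ℕ.s≤s ℕ.z≤n

      ⅟[c*k] : ∀ c → 0 ℕ.< c → ⅟ (c ℕ.* k) ≡ ⅟ c * κ
      ⅟[c*k] c 0<c = trans (cong (1ℚ ÷₀_) (ℕ→ℚ-* c k)) (1÷₀-* (ℕ→ℚ-mono-< 0<c) 0<K)

      ⅟[c*k]-pos : ∀ c → 0 ℕ.< c → 0ℚ < ⅟ (c ℕ.* k)
      ⅟[c*k]-pos c 0<c = 1÷₀-pos (subst (0ℚ <_) (sym (ℕ→ℚ-* c k)) (*-pos (ℕ→ℚ-mono-< 0<c) 0<K))

    u ρ : ℚ
    u = ⅟ (12 ℕ.* k)
    ρ = ⅟ (100 ℕ.* k)

    0≤u : 0ℚ ≤ u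
    0≤u = ℚ.<⇒≤ (⅟[c*k]-pos 12 0<suc)

    0≤ρ : 0ℚ ≤ ρ
    0≤ρ = ℚ.<⇒≤ (⅟[c*k]-pos 100 0<suc)

    module _ (a : Fin (2 ℕ.* k) → ℕ) where
      open Instance k a

      ε≡2u : ε ≡ 2 * u
      ε≡2u = begin
        ⅟ (6 ℕ.* k)      ≡⟨ ⅟[c*k] 6 0<suc ⟩
        ⅟ 6 * κ          ≡⟨ scale κ ⟩
        2 * (⅟ 12 * κ)   ≡⟨ cong (2 *_) (sym (⅟[c*k] 12 0<suc)) ⟩
        2 * u            ∎
        where
        open ≡-Reasoning
        scale : ∀ κ → ⅟ 6 * κ ≡ 2 * (⅟ 12 * κ)
        scale = solve 1 (λ κ → con (⅟ 6) :* κ := con 2 :* (con (⅟ 12) :* κ)) λ {_} → refl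

      δ≡3u : δ ≡ 3 * u
      δ≡3u = begin
        ⅟ (4 ℕ.* k)      ≡⟨ ⅟[c*k] 4 0<suc ⟩
        ⅟ 4 * κ          ≡⟨ scale κ ⟩
        3 * (⅟ 12 * κ)   ≡⟨ cong (3 *_) (sym (⅟[c*k] 12 0<suc)) ⟩
        3 * u            ∎
        where
        open ≡-Reasoning
        scale : ∀ κ → ⅟ 4 * κ ≡ 3 * (⅟ 12 * κ)
        scale = solve 1 (λ κ → con (⅟ 4) :* κ := con 3 :* (con (⅟ 12) :* κ)) λ {_} → refl

      private
        W≡ : W k a ≡ ⅟ 3 * (⅟ 2 * κ)
        W≡ = trans (cong (1ℚ ÷₀_) (ℕ→ℚ-* 3 n))
                   (trans (1÷₀-* (ℕ→ℚ-pos 2) 0<n) (cong (⅟ 3 *_) (⅟[c*k] 2 0<suc)))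
          where
          0<n : 0ℚ < ℕ→ℚ n
          0<n = subst (0ℚ <_) (sym (ℕ→ℚ-* 2 k)) (*-pos (ℕ→ℚ-pos 1) 0<K)

      0<W : 0ℚ < W k a
      0<W = subst (0ℚ <_) (sym W≡)
                  (*-pos (1÷₀-pos (ℕ→ℚ-pos 2)) (*-pos (1÷₀-pos (ℕ→ℚ-pos 1)) (1÷₀-pos 0<K)))

      εᵢ-lower : (∀ i → 0 ℕ.< a i) → (∀ i j → ℕ→ℚ (a i) ≤ (1ℚ + ρ) * ℕ→ℚ (a j)) →
                 ∀ i → 6 * u * (1 - ρ) ≤ εᵢ i
      εᵢ-lower 0<a balanced i = begin
        6 * u * (1 - ρ)
          ≤⟨ *-monoˡ-≤ 0≤6u (balanced-share-≥ (ℕ→ℚ ∘ a) 0≤ρ (ℕ→ℚ-mono-< ∘ 0<a) balanced i) ⟩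
        6 * u * (ℕ→ℚ n * εᵢ i)   ≡⟨ reassociate (6 * u) (ℕ→ℚ n) (εᵢ i) ⟩
        ℕ→ℚ n * (6 * u) * εᵢ i   ≡⟨ cong (_* εᵢ i) n6u≡1 ⟩
        1ℚ * εᵢ i                ≡⟨ ℚ.*-identityˡ (εᵢ i) ⟩
        εᵢ i                     ∎
        where
        open ≤-Reasoning
        0≤6u : 0ℚ ≤ 6 * u
        0≤6u = *-nonNeg (ℕ→ℚ-nonNeg 6) 0≤u
        reassociate : ∀ p q r → p * (q * r) ≡ q * p * r
        reassociate = solve 3 (λ p q r → p :* (q :* r) := q :* p :* r) λ {_ _ _} → refl
        n6u≡1 : ℕ→ℚ n * (6 * u) ≡ 1ℚ
        n6u≡1 = begin-equality
          ℕ→ℚ n * (6 * u)               ≡⟨ cong₂ (λ m v → m * (6 * v)) (ℕ→ℚ-* 2 k) (⅟[c*k] 12 0<suc) ⟩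
          ℕ→ℚ 2 * K * (6 * (⅟ 12 * κ))  ≡⟨ collect K κ ⟩
          κ * K                         ≡⟨ κK≡1 ⟩
          1ℚ                            ∎
          where
          collect : ∀ K κ → ℕ→ℚ 2 * K * (6 * (⅟ 12 * κ)) ≡ κ * K
          collect = solve 2 (λ K κ → con (ℕ→ℚ 2) :* K :* (con 6 :* (con (⅟ 12) :* κ)) := κ :* K)
                              λ {_ _} → refl

      threshold : ⅟ (36 ℕ.* k) < W k a * (u * (ℕ→ℚ n * (1 - 6 * ρ) + 1))
      threshold = begin-strict
        ⅟ (36 ℕ.* k)                               ≡⟨ sym (ℚ.+-identityʳ (⅟ (36 ℕ.* k))) ⟩
        ⅟ (36 ℕ.* k) + 0ℚ                          <⟨ ℚ.+-monoʳ-< (⅟ (36 ℕ.* k)) margin ⟩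
        ⅟ (36 ℕ.* k) + (⅟ 72 - ⅟ 600) * (κ * κ)    ≡⟨ sym expand ⟩
        W k a * (u * (ℕ→ℚ n * (1 - 6 * ρ) + 1))    ∎
        where
        open ≤-Reasoning
        0<κ : 0ℚ < κ
        0<κ = 1÷₀-pos 0<K
        margin : 0ℚ < (⅟ 72 - ⅟ 600) * (κ * κ)
        margin = *-pos (ℚ.positive⁻¹ (⅟ 72 - ⅟ 600)) (*-pos 0<κ 0<κ)
        F : ℚ → ℚ
        F p = ⅟ 36 * κ * p + (⅟ 72 - ⅟ 600 * p) * (κ * κ)
        expand : W k a * (u * (ℕ→ℚ n * (1 - 6 * ρ) + 1)) ≡ ⅟ (36 ℕ.* k) + (⅟ 72 - ⅟ 600) * (κ * κ)
        expand = begin-equality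
          W k a * (u * (ℕ→ℚ n * (1 - 6 * ρ) + 1))
            ≡⟨ cong₂ (λ w v → w * (v * (ℕ→ℚ n * (1 - 6 * ρ) + 1))) W≡ (⅟[c*k] 12 0<suc) ⟩
          ⅟ 3 * (⅟ 2 * κ) * (⅟ 12 * κ * (ℕ→ℚ n * (1 - 6 * ρ) + 1))
            ≡⟨ cong (λ m → ⅟ 3 * (⅟ 2 * κ) * (⅟ 12 * κ * (m * (1 - 6 * ρ) + 1))) (ℕ→ℚ-* 2 k) ⟩
          ⅟ 3 * (⅟ 2 * κ) * (⅟ 12 * κ * (ℕ→ℚ 2 * K * (1 - 6 * ρ) + 1))
            ≡⟨ cong (λ r → ⅟ 3 * (⅟ 2 * κ) * (⅟ 12 * κ * (ℕ→ℚ 2 * K * (1 - 6 * r) + 1)))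
                    (⅟[c*k] 100 0<suc) ⟩
          ⅟ 3 * (⅟ 2 * κ) * (⅟ 12 * κ * (ℕ→ℚ 2 * K * (1 - 6 * (⅟ 100 * κ)) + 1))
            ≡⟨ in-κK κ K ⟩
          F (κ * K)
            ≡⟨ cong F κK≡1 ⟩
          F 1ℚ
            ≡⟨ at-1 κ ⟩
          ⅟ 36 * κ + (⅟ 72 - ⅟ 600) * (κ * κ)
            ≡⟨ cong (_+ (⅟ 72 - ⅟ 600) * (κ * κ)) (sym (⅟[c*k] 36 0<suc)) ⟩
          ⅟ (36 ℕ.* k) + (⅟ 72 - ⅟ 600) * (κ * κ)
            ∎
          where
          in-κK : ∀ κ K → ⅟ 3 * (⅟ 2 * κ) * (⅟ 12 * κ * (ℕ→ℚ 2 * K * (1 - 6 * (⅟ 100 * κ)) + 1)) ≡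
                          ⅟ 36 * κ * (κ * K) + (⅟ 72 - ⅟ 600 * (κ * K)) * (κ * κ)
          in-κK = solve 2 (λ κ K →
            con (⅟ 3) :* (con (⅟ 2) :* κ)
              :* (con (⅟ 12) :* κ :* (con (ℕ→ℚ 2) :* K :* (con 1 :- con 6 :* (con (⅟ 100) :* κ)) :+ con 1)) :=
            con (⅟ 36) :* κ :* (κ :* K) :+ (con (⅟ 72) :- con (⅟ 600) :* (κ :* K)) :* (κ :* κ))
            λ {_ _} → refl
          at-1 : ∀ κ → ⅟ 36 * κ * 1ℚ + (⅟ 72 - ⅟ 600 * 1ℚ) * (κ * κ) ≡
                       ⅟ 36 * κ + (⅟ 72 - ⅟ 600) * (κ * κ)
          at-1 = solve 1 (λ κ →
            con (⅟ 36) :* κ :* con 1ℚ :+ (con (⅟ 72) :- con (⅟ 600) :* con 1ℚ) :* (κ :* κ) :=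
            con (⅟ 36) :* κ :+ (con (⅟ 72) :- con (⅟ 600)) :* (κ :* κ))
            λ {_} → refl

open import Defs
open import Data.Nat using (ℕ; _≤_; _<_; _*_)
open import Data.Fin using (Fin)
open import Relation.Nullary using (¬_)
open import Data.Rational using (ℚ; 1ℚ) renaming (_<_ to _<ℚ_; _≤_ to _≤ℚ_; _+_ to _+ℚ_; _*_ to _*ℚ_)
open import Data.Rational.Properties using (<-≤-trans)
open CostLowerBound using (module Units; module CostBound)

lemma6p11 : (k : ℕ) → 1 ≤ k → (a : Fin (2 * k) → ℕ) → (∀ i → 0 < a i) → (∀ i j → ℕ→ℚ (a i) ≤ℚ (1ℚ +ℚ (1ℚ ÷₀ ℕ→ℚ (100 * k))) *ℚ ℕ→ℚ (a j)) → ∀ {m} (P : Elem (2 * k) → Fin m) → ¬ Instance.Regular k a P → 1ℚ ÷₀ ℕ→ℚ (36 * k) <ℚ Instance.cost k a P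
lemma6p11 k 0<k a 0<a balanced P ¬regular = <-≤-trans (threshold a) (cost-bound P ¬regular)
  where
  open Units k 0<k
  open CostBound k a u ρ 0≤u 0≤ρ (0<W a) (ε≡2u a) (δ≡3u a) (εᵢ-lower a 0<a balanced)
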